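{- Consider the $2$-Labeled Coupon Collector Problem on $n$ coupons, and after any finite sequence of samples let $H=(C,S)$ be the graph whose vertex set is the coupon set $C$ and in which $\{c,c'\}$ is an edge if and only if $\{c,c'\}$ was drawn as a sample. Then a coupon $c\in C$ has its label determined if and only if $c$ lies in a connected component of $H$ with at least $3$ vertices.
   Context: $2$-Labeled Coupon Collector Problem: there are $n$ coupons $C$ and $n$ labels $L$ with an unknown bijection $\sigma:C\to L$. Samples are independent; each sample is a uniformly random $2$-element subset $S\subseteq C$, and the collector observes only the pair of sets $(S,\sigma(S))$, not which label goes with which coupon. The collector has no prior knowledge of $C$ and $L$ beyond what appears in samples. After samples $(S_1,\sigma(S_1)),\dots,(S_t,\sigma(S_t))$, let $C_t=\bigcup_i S_i$ and $L_t=\bigcup_i\sigma(S_i)$; a bijection $f:C_t\to L_t$ is consistent if $f(S_i)=\sigma(S_i)$ for all $i$. A coupon $c$ has its label determined if $c\in C_t$ and $f(c)$ is the same for all consistent $f$. -}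

module Defs where

open import Data.Nat using (ℕ)
open import Data.Fin using (Fin)
open import Data.Fin.Permutation using (Permutation′; _⟨$⟩ʳ_)
open import Data.Product using (Σ; ∃; _×_; _,_; proj₁; proj₂)
open import Data.Sum using (_⊎_)
open import Data.List using (List)
open import Data.List.Membership.Propositional using (_∈_)
open import Relation.Binary.PropositionalEquality using (_≡_; _≢_)
open import Relation.Binary.Construct.Closure.ReflexiveTransitive using (Star)

-- A sample: a 2-element subset {a , b} of the coupon set Fin n, given by two
-- distinct coupons (the order of the pair carries no meaning).
Sample : ℕ → Set
Sample n = Σ (Fin n × Fin n) λ p → proj₁ p ≢ proj₂ p

_∈₂_ : ∀ {n} → Fin n → Fin n × Fin n → Set
x ∈₂ (a , b) = x ≡ a ⊎ x ≡ b

img : ∀ {n} → (Fin n → Fin n) → Sample n → Fin n × Fin n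
img h ((a , b) , _) = (h a , h b)

_≐₂_ : ∀ {n} → Fin n × Fin n → Fin n × Fin n → Set
P ≐₂ Q = ∀ z → (z ∈₂ P → z ∈₂ Q) × (z ∈₂ Q → z ∈₂ P)

module _ {n : ℕ} (σ : Permutation′ n) (samples : List (Sample n)) where

  InC : Fin n → Set
  InC c = ∃ λ s → s ∈ samples × c ∈₂ proj₁ s

  InL : Fin n → Set
  InL l = ∃ λ s → s ∈ samples × l ∈₂ img (σ ⟨$⟩ʳ_) s

  -- f (restricted to C_t) is a bijection C_t → L_t with f(S_i) = σ(S_i) for
  -- all i. Values of f outside C_t are irrelevant.
  Consistent : (Fin n → Fin n) → Set
  Consistent f =
      (∀ c → InC c → InL (f c))
    × (∀ c c′ → InC c → InC c′ → f c ≡ f c′ → c ≡ c′)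
    × (∀ l → InL l → ∃ λ c → InC c × f c ≡ l)
    × (∀ s → s ∈ samples → img f s ≐₂ img (σ ⟨$⟩ʳ_) s)

  Determined : Fin n → Set
  Determined c = InC c × (∀ f g → Consistent f → Consistent g → f c ≡ g c)

  Adj : Fin n → Fin n → Set
  Adj x y = ∃ λ s → s ∈ samples × img (λ z → z) s ≐₂ (x , y)

  Reach : Fin n → Fin n → Set
  Reach = Star Adj

  BigComponent : Fin n → Set
  BigComponent c = ∃ λ x → ∃ λ y → ∃ λ z →
      Reach c x × Reach c y × Reach c z × x ≢ y × y ≢ z × x ≢ z

-- If c has a neighbour v, every consistent labelling f sends c to σ c or to
-- σ v. In the second case f must swap the labels of c and v, and then every
-- edge at c or at v stays inside {c , v}; so in a component with at least
-- three vertices f c = σ c. Conversely, if c is determined, take a sample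
-- {c , d}. If no sample has exactly one coupon in {c , d}, then σ composed
-- with the transposition of c and d is another consistent labelling, which
-- moves the label of c; so some sample leaves {c , d}, and its outer coupon
-- is a third vertex of the component of c.
module Submission where

open import Defs
open import Data.Nat using (ℕ)
open import Data.Fin using (Fin; _≟_)
open import Data.Fin.Permutation using (Permutation′; _⟨$⟩ʳ_; id; transpose)
import Data.Fin.Permutation.Components as PC
open import Data.List using (List)
open import Data.List.Membership.Propositional using (_∈_; find; lose)
open import Data.List.Relation.Unary.Any using (any?)
open import Data.Product using (_×_; ∃; _,_; proj₁; proj₂)
open import Data.Sum using (_⊎_; inj₁; inj₂)
open import Data.Empty using (⊥; ⊥-elim)
open import Function.Bundles using (Injection)
open import Function.Properties.Inverse using (↔⇒↣)
open import Function.Definitions using (Injective)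
open import Relation.Nullary using (¬_; Dec; yes; no; contradiction)
open import Relation.Nullary.Decidable using (_×-dec_; _⊎-dec_; ¬?)
open import Relation.Binary.PropositionalEquality using (_≡_; _≢_; refl; sym; trans)
open import Relation.Binary.Construct.Closure.ReflexiveTransitive using (Star; ε; _◅_; fold)

module _ {n : ℕ} where

  ≐₂-refl : {P : Fin n × Fin n} → P ≐₂ P
  ≐₂-refl z = (λ z∈ → z∈) , (λ z∈ → z∈)

  ≐₂-sym : {P Q : Fin n × Fin n} → P ≐₂ Q → Q ≐₂ P
  ≐₂-sym P≐Q z = proj₂ (P≐Q z) , proj₁ (P≐Q z)

  ≐₂-trans : {P Q R : Fin n × Fin n} → P ≐₂ Q → Q ≐₂ R → P ≐₂ R
  ≐₂-trans P≐Q Q≐R z = (λ z∈ → proj₁ (Q≐R z) (proj₁ (P≐Q z) z∈))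
                     , (λ z∈ → proj₂ (P≐Q z) (proj₂ (Q≐R z) z∈))

  ∈₂-diagonal : {z a : Fin n} → z ∈₂ (a , a) → z ≡ a
  ∈₂-diagonal (inj₁ z≡a) = z≡a
  ∈₂-diagonal (inj₂ z≡a) = z≡a

  ∈₂-swap : {z a b : Fin n} → z ∈₂ (a , b) → z ∈₂ (b , a)
  ∈₂-swap (inj₁ z≡a) = inj₂ z≡a
  ∈₂-swap (inj₂ z≡b) = inj₁ z≡b

  ≐₂-swap : {a b : Fin n} → (a , b) ≐₂ (b , a)
  ≐₂-swap z = ∈₂-swap , ∈₂-swap

  ∈₂? : (x : Fin n) (P : Fin n × Fin n) → Dec (x ∈₂ P)
  ∈₂? x (a , b) = (x ≟ a) ⊎-dec (x ≟ b)

  ∈₂-map : {x a b : Fin n} (h : Fin n → Fin n) → x ∈₂ (a , b) → h x ∈₂ (h a , h b)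
  ∈₂-map h (inj₁ refl) = inj₁ refl
  ∈₂-map h (inj₂ refl) = inj₂ refl

  ∈₂-map⁻ : {y a b : Fin n} (h : Fin n → Fin n) → y ∈₂ (h a , h b) →
            ∃ λ x → x ∈₂ (a , b) × h x ≡ y
  ∈₂-map⁻ h (inj₁ refl) = _ , inj₁ refl , refl
  ∈₂-map⁻ h (inj₂ refl) = _ , inj₂ refl , refl

  ∈₂-⊆ : {z a b : Fin n} {P : Fin n × Fin n} → z ∈₂ (a , b) → a ∈₂ P → b ∈₂ P → z ∈₂ P
  ∈₂-⊆ (inj₁ refl) a∈P b∈P = a∈P
  ∈₂-⊆ (inj₂ refl) a∈P b∈P = b∈P

  ≐₂-map : {a b a′ b′ : Fin n} (h : Fin n → Fin n) →
           (a , b) ≐₂ (a′ , b′) → (h a , h b) ≐₂ (h a′ , h b′)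
  ≐₂-map {a} {b} {a′} {b′} h e z =
      (λ z∈ → ∈₂-⊆ z∈ (∈₂-map h (proj₁ (e a) (inj₁ refl))) (∈₂-map h (proj₁ (e b) (inj₂ refl))))
    , (λ z∈ → ∈₂-⊆ z∈ (∈₂-map h (proj₂ (e a′) (inj₁ refl))) (∈₂-map h (proj₂ (e b′) (inj₂ refl))))

  ≐₂-distinct : {u v : Fin n} (P : Fin n × Fin n) → u ∈₂ P → v ∈₂ P → u ≢ v → P ≐₂ (u , v)
  ≐₂-distinct _ (inj₁ refl) (inj₁ refl) u≢v = contradiction refl u≢v
  ≐₂-distinct _ (inj₁ refl) (inj₂ refl) u≢v = ≐₂-refl
  ≐₂-distinct _ (inj₂ refl) (inj₁ refl) u≢v = ≐₂-swap
  ≐₂-distinct _ (inj₂ refl) (inj₂ refl) u≢v = contradiction refl u≢v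

  ∈₂-other : {c a b : Fin n} → c ∈₂ (a , b) → a ≢ b → ∃ λ d → c ≢ d × d ∈₂ (a , b)
  ∈₂-other (inj₁ refl) a≢b = _ , a≢b , inj₂ refl
  ∈₂-other (inj₂ refl) a≢b = _ , (λ b≡a → a≢b (sym b≡a)) , inj₁ refl

  ∈₂-no-three : {x y z a b : Fin n} → x ∈₂ (a , b) → y ∈₂ (a , b) → z ∈₂ (a , b) →
                x ≢ y → y ≢ z → x ≢ z → ⊥
  ∈₂-no-three (inj₁ refl) (inj₁ refl) _           x≢y y≢z x≢z = x≢y refl
  ∈₂-no-three (inj₂ refl) (inj₂ refl) _           x≢y y≢z x≢z = x≢y refl
  ∈₂-no-three (inj₁ refl) (inj₂ refl) (inj₁ refl) x≢y y≢z x≢z = x≢z refl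
  ∈₂-no-three (inj₁ refl) (inj₂ refl) (inj₂ refl) x≢y y≢z x≢z = y≢z refl
  ∈₂-no-three (inj₂ refl) (inj₁ refl) (inj₁ refl) x≢y y≢z x≢z = y≢z refl
  ∈₂-no-three (inj₂ refl) (inj₁ refl) (inj₂ refl) x≢y y≢z x≢z = x≢z refl

  Crosses : Fin n × Fin n → Sample n → Set
  Crosses P ((p , q) , _) = (p ∈₂ P × ¬ q ∈₂ P) ⊎ (q ∈₂ P × ¬ p ∈₂ P)

  crosses? : (P : Fin n × Fin n) (s : Sample n) → Dec (Crosses P s)
  crosses? P ((p , q) , _) =
    (∈₂? p P ×-dec ¬? (∈₂? q P)) ⊎-dec (∈₂? q P ×-dec ¬? (∈₂? p P))

  noncrossing-img-≐₂ : (P : Fin n × Fin n) {π : Fin n → Fin n} → Injective _≡_ _≡_ π →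
                       (∀ {x} → x ∈₂ P → π x ∈₂ P) → (∀ {x} → ¬ x ∈₂ P → π x ≡ x) →
                       (s : Sample n) → ¬ Crosses P s → img π s ≐₂ proj₁ s
  noncrossing-img-≐₂ P π-inj π-in π-out ((p , q) , p≢q) ¬cross
    with ∈₂? p P | ∈₂? q P
  ... | yes p∈ | yes q∈ =
    ≐₂-trans (≐₂-sym (≐₂-distinct P (π-in p∈) (π-in q∈) (λ πp≡πq → p≢q (π-inj πp≡πq))))
             (≐₂-distinct P p∈ q∈ p≢q)
  ... | yes p∈ | no q∉  = contradiction (inj₁ (p∈ , q∉)) ¬cross
  ... | no p∉  | yes q∈ = contradiction (inj₂ (q∈ , p∉)) ¬cross
  ... | no p∉  | no q∉  rewrite π-out p∉ | π-out q∉ = ≐₂-refl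

  transpose-∈₂ : {i j x : Fin n} → x ∈₂ (i , j) → PC.transpose i j x ∈₂ (i , j)
  transpose-∈₂ {i} {j} {x} x∈ with x ≟ i
  ... | yes _ = inj₂ refl
  ... | no _ with x ≟ j
  ...   | yes _ = inj₁ refl
  ...   | no _  = x∈

  transpose-∉₂ : {i j x : Fin n} → ¬ x ∈₂ (i , j) → PC.transpose i j x ≡ x
  transpose-∉₂ {i} {j} {x} x∉ with x ≟ i
  ... | yes x≡i = contradiction (inj₁ x≡i) x∉
  ... | no x≢i with x ≟ j
  ...   | yes x≡j = contradiction (inj₂ x≡j) x∉
  ...   | no _    = refl

  transpose-matchˡ : (i j : Fin n) → PC.transpose i j i ≡ j
  transpose-matchˡ i j with i ≟ i
  ... | yes _  = refl
  ... | no i≢i = contradiction refl i≢i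

Star-preserves : {A : Set} {R : A → A → Set} (P : A → Set) →
                 (∀ {x y} → R x y → P x → P y) → ∀ {x y} → Star R x y → P x → P y
Star-preserves P step = fold (λ x y → P x → P y) (λ r k px → k (step r px)) (λ px → px)

⟨$⟩ʳ-injective : ∀ {n} (π : Permutation′ n) → Injective _≡_ _≡_ (π ⟨$⟩ʳ_)
⟨$⟩ʳ-injective π = Injection.injective (↔⇒↣ π)

module _ {n : ℕ} (σ : Permutation′ n) (samples : List (Sample n)) where

  private
    σ′ : Fin n → Fin n
    σ′ x = σ ⟨$⟩ʳ x

    σ-injective : ∀ {x y} → σ′ x ≡ σ′ y → x ≡ y
    σ-injective = ⟨$⟩ʳ-injective σ

  FixesSamples : (Fin n → Fin n) → Set
  FixesSamples π = ∀ s → s ∈ samples → img π s ≐₂ proj₁ s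

  relabel-consistent : (π : Permutation′ n) → FixesSamples (π ⟨$⟩ʳ_) →
                       Consistent σ samples (λ x → σ ⟨$⟩ʳ (π ⟨$⟩ʳ x))
  relabel-consistent π fixes = inC→inL , injective , onto , on-samples
    where
    π′ : Fin n → Fin n
    π′ x = π ⟨$⟩ʳ x

    inC→inL : ∀ x → InC σ samples x → InL σ samples (σ′ (π′ x))
    inC→inL x (s , s∈ , x∈) = s , s∈ , ∈₂-map σ′ (proj₁ (fixes s s∈ (π′ x)) (∈₂-map π′ x∈))

    injective : ∀ x y → InC σ samples x → InC σ samples y → σ′ (π′ x) ≡ σ′ (π′ y) → x ≡ y
    injective x y _ _ e = ⟨$⟩ʳ-injective π (σ-injective e)

    onto : ∀ l → InL σ samples l → ∃ λ x → InC σ samples x × σ′ (π′ x) ≡ l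
    onto l (s , s∈ , l∈) with ∈₂-map⁻ σ′ l∈
    ... | y , y∈ , refl with ∈₂-map⁻ π′ (proj₂ (fixes s s∈ y) y∈)
    ...   | x , x∈ , refl = x , (s , s∈ , x∈) , refl

    on-samples : ∀ s → s ∈ samples → img (λ x → σ′ (π′ x)) s ≐₂ img σ′ s
    on-samples s s∈ = ≐₂-map σ′ (fixes s s∈)

  σ-consistent : Consistent σ samples σ′
  σ-consistent = relabel-consistent id (λ _ _ → ≐₂-refl)

  sample-adj : ∀ {s u v} → s ∈ samples → u ∈₂ proj₁ s → v ∈₂ proj₁ s → u ≢ v →
               Adj σ samples u v
  sample-adj {s} s∈ u∈ v∈ u≢v = s , s∈ , ≐₂-distinct (proj₁ s) u∈ v∈ u≢v

  adj-sym : ∀ {u v} → Adj σ samples u v → Adj σ samples v u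
  adj-sym (s , s∈ , e) = s , s∈ , ≐₂-trans e ≐₂-swap

  adj-irrefl : ∀ {u v} → Adj σ samples u v → u ≢ v
  adj-irrefl (((p , q) , p≢q) , _ , e) refl =
    p≢q (trans (∈₂-diagonal (proj₁ (e p) (inj₁ refl))) (sym (∈₂-diagonal (proj₁ (e q) (inj₂ refl)))))

  adj-inC : ∀ {u v} → Adj σ samples u v → InC σ samples u
  adj-inC (s , s∈ , e) = s , s∈ , proj₂ (e _) (inj₁ refl)

  consistent-edge : ∀ {f u v} → Consistent σ samples f → Adj σ samples u v → f u ∈₂ (σ′ u , σ′ v)
  consistent-edge {f} {u} (_ , _ , _ , on-samples) (((p , q) , _) , s∈ , e) =
    ∈₂-⊆ (proj₁ (on-samples _ s∈ (f u)) (∈₂-map f (proj₂ (e u) (inj₁ refl))))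
         (∈₂-map σ′ (proj₁ (e p) (inj₁ refl)))
         (∈₂-map σ′ (proj₁ (e q) (inj₂ refl)))

  consistent-edge-target : ∀ {f u u′ w} → Consistent σ samples f → Adj σ samples u w →
                           f u ≡ σ′ u′ → u′ ≢ u → w ≡ u′
  consistent-edge-target cf uw fu≡σu′ u′≢u with consistent-edge cf uw
  ... | inj₁ fu≡σu = contradiction (σ-injective (trans (sym fu≡σu′) fu≡σu)) u′≢u
  ... | inj₂ fu≡σw = σ-injective (trans (sym fu≡σw) fu≡σu′)

  swapped-edge-isolated : ∀ {f c v w} → Consistent σ samples f → Adj σ samples c v →
                          f c ≡ σ′ v → Reach σ samples c w → w ∈₂ (c , v)
  swapped-edge-isolated {f} {c} {v} cf cv fc≡σv =
    λ c⇝w → Star-preserves (_∈₂ (c , v)) step c⇝w (inj₁ refl)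
    where
    v≢c : v ≢ c
    v≢c v≡c = adj-irrefl cv (sym v≡c)

    fv≡σc : f v ≡ σ′ c
    fv≡σc with consistent-edge cf (adj-sym cv)
    ... | inj₁ fv≡σv = contradiction (proj₁ (proj₂ cf) _ _ (adj-inC (adj-sym cv)) (adj-inC cv)
                                               (trans fv≡σv (sym fc≡σv))) v≢c
    ... | inj₂ fv≡σc = fv≡σc

    step : ∀ {x y} → Adj σ samples x y → x ∈₂ (c , v) → y ∈₂ (c , v)
    step xy (inj₁ refl) = inj₂ (consistent-edge-target cf xy fc≡σv v≢c)
    step xy (inj₂ refl) = inj₁ (consistent-edge-target cf xy fv≡σc (λ c≡v → v≢c (sym c≡v)))

  big-neighbour : ∀ {c} → BigComponent σ samples c → ∃ λ v → Adj σ samples c v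
  big-neighbour (_ , _ , _ , ε      , ε      , _ , x≢y , _) = contradiction refl x≢y
  big-neighbour (_ , _ , _ , ε      , cv ◅ _ , _)           = _ , cv
  big-neighbour (_ , _ , _ , cv ◅ _ , _)                    = _ , cv

  big-fixes-label : ∀ {c f} → BigComponent σ samples c → Consistent σ samples f → f c ≡ σ′ c
  big-fixes-label {c} big@(_ , _ , _ , c⇝x , c⇝y , c⇝z , x≢y , y≢z , x≢z) cf
    with big-neighbour big
  ... | v , cv with consistent-edge cf cv
  ...   | inj₁ fc≡σc = fc≡σc
  ...   | inj₂ fc≡σv = ⊥-elim (∈₂-no-three (isolated c⇝x) (isolated c⇝y) (isolated c⇝z) x≢y y≢z x≢z)
    where
    isolated : ∀ {w} → Reach σ samples c w → w ∈₂ (c , v)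
    isolated = swapped-edge-isolated cf cv fc≡σv

  big→determined : ∀ c → BigComponent σ samples c → Determined σ samples c
  big→determined c big =
      adj-inC (proj₂ (big-neighbour big))
    , λ f g cf cg → trans (big-fixes-label big cf) (sym (big-fixes-label big cg))

  leaving-big : ∀ {c d t e} → Adj σ samples c d → Adj σ samples t e →
                t ∈₂ (c , d) → ¬ e ∈₂ (c , d) → BigComponent σ samples c
  leaving-big {c} {d} {t} {e} cd te t∈ e∉ =
    c , d , e , ε , cd ◅ ε , c⇝e t∈ ,
    adj-irrefl cd , (λ d≡e → e∉ (inj₂ (sym d≡e))) , (λ c≡e → e∉ (inj₁ (sym c≡e)))
    where
    c⇝e : t ∈₂ (c , d) → Reach σ samples c e
    c⇝e (inj₁ refl) = te ◅ ε
    c⇝e (inj₂ refl) = cd ◅ te ◅ ε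

  crossing-big : ∀ {c d} → Adj σ samples c d → (s : Sample n) → s ∈ samples →
                 Crosses (c , d) s → BigComponent σ samples c
  crossing-big cd ((p , q) , p≢q) s∈ (inj₁ (p∈ , q∉)) =
    leaving-big cd (sample-adj s∈ (inj₁ refl) (inj₂ refl) p≢q) p∈ q∉
  crossing-big cd ((p , q) , p≢q) s∈ (inj₂ (q∈ , p∉)) =
    leaving-big cd (sample-adj s∈ (inj₂ refl) (inj₁ refl) (λ q≡p → p≢q (sym q≡p))) q∈ p∉

  transpose-fixes-samples : ∀ {c d} → (∀ s → s ∈ samples → ¬ Crosses (c , d) s) →
                            FixesSamples (transpose c d ⟨$⟩ʳ_)
  transpose-fixes-samples {c} {d} none s s∈ =
    noncrossing-img-≐₂ (c , d) (⟨$⟩ʳ-injective (transpose c d))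
                       transpose-∈₂ transpose-∉₂ s (none s s∈)

  adj-determined→big : ∀ {c d} → Adj σ samples c d → Determined σ samples c →
                       BigComponent σ samples c
  adj-determined→big {c} {d} cd (_ , det) with any? (crosses? (c , d)) samples
  ... | yes crossing = let s , s∈ , cross = find crossing in crossing-big cd s s∈ cross
  ... | no none = contradiction (trans (sym τc≡c) (transpose-matchˡ c d)) (adj-irrefl cd)
    where
    τ : Permutation′ n
    τ = transpose c d

    τc≡c : τ ⟨$⟩ʳ c ≡ c
    τc≡c = σ-injective (det _ _ (relabel-consistent τ (transpose-fixes-samples
                                   (λ s s∈ cross → none (lose s∈ cross))))
                                 σ-consistent)

  inC-neighbour : ∀ {c} → InC σ samples c → ∃ λ d → Adj σ samples c d
  inC-neighbour (((a , b) , a≢b) , s∈ , c∈) with ∈₂-other c∈ a≢b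
  ... | d , c≢d , d∈ = d , sample-adj s∈ c∈ d∈ c≢d

  determined→big : ∀ c → Determined σ samples c → BigComponent σ samples c
  determined→big c det = adj-determined→big (proj₂ (inC-neighbour (proj₁ det))) det

lemma2 : (n : ℕ) (σ : Permutation′ n) (samples : List (Sample n)) (c : Fin n) →
    (Determined σ samples c → BigComponent σ samples c)
    × (BigComponent σ samples c → Determined σ samples c)
lemma2 n σ samples c = determined→big σ samples c , big→determined σ samples c
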